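{- For every $I$-pointed partially observable $FT(\_)^A$-coalgebra $(i,c)$, where $i\colon I\to S$ and $c=\langle\delta,\mathrm{obs}\rangle\colon S\to (FTS)^A\times O$, one has $V(i,c)=H(i,c)$.
   Context: $\mathcal{C}$ is a cartesian closed category with finite products, pullbacks and countable coproducts; for $f\colon X\times Y\to Z$, $f^\dagger\colon X\to Z^Y$ is its transpose (and conversely). $T=(T,\eta,\mu)$ is a strong monad and $F$ a strong endofunctor; $\mathrm{st}$ denotes the strengths of $T$, $F$ and $FT$ (the latter $F\mathrm{st}^T\circ\mathrm{st}^F$), applied on either side via the symmetry of $\times$. $A$ and $I$ are fixed objects. $\Omega$ is an ordered object (every $\mathcal{C}(X,\Omega)$ a complete lattice, precomposition preserving arbitrary joins, bottom $\bot$) and $\tau\colon FT\Omega\to\Omega$ a monotone algebra ($g\mapsto\tau\circ FTg$ monotone). For an $FT$-coalgebra $e\colon X\to FTX$, $\Phi_e(g):=\tau\circ FTg\circ e$ on $\mathcal{C}(X,\Omega)$. Sequences: $X^*=\coprod_{n\ge0}X^n$, $X^+=\coprod_{n\ge1}X^n$ (functorial, e.g. $\mathrm{obs}^+$ applies $\mathrm{obs}$ componentwise); $\mathsf{nil}_X\colon X\to X^+$ is the coprojection of length-one sequences; $\mathsf{cons}_O\colon O\times O^*\to O^+$ the canonical isomorphism; $\mathsf{ext}_S\colon S^+\times S\to S^+$ the concatenation (appending an element); $\mathrm{last}\colon S^+\to S$ the last element. $O^*\cong1+O^+$ induces $A^{O^*}\cong A\times A^{O^+}$; $\mathrm{ev}\colon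 O\times A^{O^+}\to A^{O^*}$ is the transpose of $(o,h,w)\mapsto h(\mathsf{cons}_O(o,w))$. $\mathsf{Sch}(c)\colon S\times A^{O^*}\to FT(S\times A^{O^*})$ is $S\times A^{O^*}\cong S\times A\times A^{O^+}\xrightarrow{\delta^\dagger\times\mathrm{id}}FTS\times A^{O^+}\xrightarrow{\mathrm{st}}FT(S\times A^{O^+})\xrightarrow{FT\langle\pi_1,\mathrm{ev}\circ(\mathrm{obs}\times\mathrm{id})\rangle}FT(S\times A^{O^*})$, and $V(i,c):=\bigvee_{u\colon O^+\to A,\,n\in\mathbb{N}}\Phi^n_{\mathsf{Sch}(c)}(\bot)\circ\langle\mathrm{id}_S,(u\circ\mathsf{cons}_O)^\dagger\circ\mathrm{obs}\rangle\circ i$. For a partially observable coalgebra $e=\langle\gamma,p\rangle\colon X\to (FTX)^A\times P$ and $u\colon P\to A$, $e_u:=\mathrm{ev}\circ\langle\gamma,u\circ p\rangle\colon X\to FTX$. $\mathsf{Hist}(c):=\langle h,\mathrm{obs}^+\rangle\colon S^+\to (FT(S^+))^A\times O^+$ where $h$ is $S^+\xrightarrow{\langle\mathrm{id},\delta\circ\mathrm{last}\rangle}S^+\times (FTS)^A\xrightarrow{(\mathrm{st}\circ(\mathrm{id}_{S^+}\times\mathrm{ev}))^\dagger}(FT(S^+\times S))^A\xrightarrow{(FT\mathsf{ext}_S)^A}(FT(S^+))^A$. Finally $H(i,c):=\bigvee_{u\colon O^+\to A,\,n\in\mathbb{N}}\Phi^n_{\mathsf{Hist}(c)_u}(\bot)\circ\mathsf{nil}_S\circ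 i$. -}

module Defs where

open import Level using (Level; _⊔_; Lift) renaming (suc to lsuc)
open import Data.Nat using (ℕ; zero; suc)
import Data.Product as P
open import Data.Empty using (⊥)
open import Relation.Binary.PropositionalEquality using (_≡_)

record Category (o ℓ : Level) : Set (lsuc (o ⊔ ℓ)) where
  infixr 9 _∘_
  field
    Obj : Set o
    Hom : Obj → Obj → Set ℓ
    id  : ∀ {X} → Hom X X
    _∘_ : ∀ {X Y Z} → Hom Y Z → Hom X Y → Hom X Z
    identityˡ : ∀ {X Y} {f : Hom X Y} → id ∘ f ≡ f
    identityʳ : ∀ {X Y} {f : Hom X Y} → f ∘ id ≡ f
    assoc : ∀ {W X Y Z} {f : Hom W X} {g : Hom X Y} {h : Hom Y Z} →
            (h ∘ g) ∘ f ≡ h ∘ (g ∘ f)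

record CCC (o ℓ : Level) : Set (lsuc (o ⊔ ℓ)) where
  field
    category : Category o ℓ
  open Category category public
  infixr 7 _×_
  infixr 6 _+_
  field
    ⊤ : Obj
    ! : ∀ {X} → Hom X ⊤
    !-unique : ∀ {X} (f : Hom X ⊤) → f ≡ !
    _×_ : Obj → Obj → Obj
    π₁ : ∀ {X Y} → Hom (X × Y) X
    π₂ : ∀ {X Y} → Hom (X × Y) Y
    ⟨_,_⟩ : ∀ {W X Y} → Hom W X → Hom W Y → Hom W (X × Y)
    π₁-⟨⟩ : ∀ {W X Y} {f : Hom W X} {g : Hom W Y} → π₁ ∘ ⟨ f , g ⟩ ≡ f
    π₂-⟨⟩ : ∀ {W X Y} {f : Hom W X} {g : Hom W Y} → π₂ ∘ ⟨ f , g ⟩ ≡ g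
    ⟨⟩-unique : ∀ {W X Y} {f : Hom W X} {g : Hom W Y} {h : Hom W (X × Y)} →
                π₁ ∘ h ≡ f → π₂ ∘ h ≡ g → h ≡ ⟨ f , g ⟩
    _^_ : Obj → Obj → Obj
    eval : ∀ {Y Z} → Hom ((Z ^ Y) × Y) Z
    curry : ∀ {X Y Z} → Hom (X × Y) Z → Hom X (Z ^ Y)
    eval-curry : ∀ {X Y Z} {f : Hom (X × Y) Z} →
                 eval ∘ ⟨ curry f ∘ π₁ , π₂ ⟩ ≡ f
    curry-unique : ∀ {X Y Z} {f : Hom (X × Y) Z} {g : Hom X (Z ^ Y)} →
                   eval ∘ ⟨ g ∘ π₁ , π₂ ⟩ ≡ f → g ≡ curry f
    Pb : ∀ {X Y Z} → Hom X Z → Hom Y Z → Obj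
    pb₁ : ∀ {X Y Z} {f : Hom X Z} {g : Hom Y Z} → Hom (Pb f g) X
    pb₂ : ∀ {X Y Z} {f : Hom X Z} {g : Hom Y Z} → Hom (Pb f g) Y
    pb-comm : ∀ {X Y Z} {f : Hom X Z} {g : Hom Y Z} → f ∘ pb₁ {f = f} {g} ≡ g ∘ pb₂
    pb-⟨⟩ : ∀ {W X Y Z} {f : Hom X Z} {g : Hom Y Z} (h₁ : Hom W X) (h₂ : Hom W Y) →
            f ∘ h₁ ≡ g ∘ h₂ → Hom W (Pb f g)
    pb₁-⟨⟩ : ∀ {W X Y Z} {f : Hom X Z} {g : Hom Y Z} {h₁ : Hom W X} {h₂ : Hom W Y}
             {eq : f ∘ h₁ ≡ g ∘ h₂} → pb₁ ∘ pb-⟨⟩ h₁ h₂ eq ≡ h₁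
    pb₂-⟨⟩ : ∀ {W X Y Z} {f : Hom X Z} {g : Hom Y Z} {h₁ : Hom W X} {h₂ : Hom W Y}
             {eq : f ∘ h₁ ≡ g ∘ h₂} → pb₂ ∘ pb-⟨⟩ h₁ h₂ eq ≡ h₂
    pb-unique : ∀ {W X Y Z} {f : Hom X Z} {g : Hom Y Z} {h₁ : Hom W X} {h₂ : Hom W Y}
                {eq : f ∘ h₁ ≡ g ∘ h₂} {k : Hom W (Pb f g)} →
                pb₁ ∘ k ≡ h₁ → pb₂ ∘ k ≡ h₂ → k ≡ pb-⟨⟩ h₁ h₂ eq
    𝟘 : Obj
    ¡ : ∀ {X} → Hom 𝟘 X
    ¡-unique : ∀ {X} (f : Hom 𝟘 X) → f ≡ ¡
    _+_ : Obj → Obj → Obj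
    i₁ : ∀ {X Y} → Hom X (X + Y)
    i₂ : ∀ {X Y} → Hom Y (X + Y)
    [_,_] : ∀ {X Y Z} → Hom X Z → Hom Y Z → Hom (X + Y) Z
    [,]-i₁ : ∀ {X Y Z} {f : Hom X Z} {g : Hom Y Z} → [ f , g ] ∘ i₁ ≡ f
    [,]-i₂ : ∀ {X Y Z} {f : Hom X Z} {g : Hom Y Z} → [ f , g ] ∘ i₂ ≡ g
    [,]-unique : ∀ {X Y Z} {f : Hom X Z} {g : Hom Y Z} {h : Hom (X + Y) Z} →
                 h ∘ i₁ ≡ f → h ∘ i₂ ≡ g → h ≡ [ f , g ]
    ∐ : (ℕ → Obj) → Obj
    ι : ∀ {X : ℕ → Obj} (n : ℕ) → Hom (X n) (∐ X)
    ⟪_⟫ : ∀ {X : ℕ → Obj} {Y} → ((n : ℕ) → Hom (X n) Y) → Hom (∐ X) Y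
    ⟪⟫-ι : ∀ {X : ℕ → Obj} {Y} {f : (n : ℕ) → Hom (X n) Y} (n : ℕ) →
           ⟪ f ⟫ ∘ ι {X} n ≡ f n
    ⟪⟫-unique : ∀ {X : ℕ → Obj} {Y} {f : (n : ℕ) → Hom (X n) Y} {h : Hom (∐ X) Y} →
                (∀ n → h ∘ ι {X} n ≡ f n) → h ≡ ⟪ f ⟫

  infixr 8 _⁂_
  _⁂_ : ∀ {X X' Y Y'} → Hom X X' → Hom Y Y' → Hom (X × Y) (X' × Y')
  f ⁂ g = ⟨ f ∘ π₁ , g ∘ π₂ ⟩

  swap : ∀ {X Y} → Hom (X × Y) (Y × X)
  swap = ⟨ π₂ , π₁ ⟩

  assocʳ : ∀ {X Y Z} → Hom ((X × Y) × Z) (X × (Y × Z))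
  assocʳ = ⟨ π₁ ∘ π₁ , ⟨ π₂ ∘ π₁ , π₂ ⟩ ⟩

  assocˡ : ∀ {X Y Z} → Hom (X × (Y × Z)) ((X × Y) × Z)
  assocˡ = ⟨ ⟨ π₁ , π₁ ∘ π₂ ⟩ , π₂ ∘ π₂ ⟩

record Endofunctor {o ℓ} (C : CCC o ℓ) : Set (o ⊔ ℓ) where
  open CCC C
  field
    F₀ : Obj → Obj
    F₁ : ∀ {X Y} → Hom X Y → Hom (F₀ X) (F₀ Y)
    F-id : ∀ {X} → F₁ (id {X}) ≡ id
    F-∘ : ∀ {X Y Z} {f : Hom X Y} {g : Hom Y Z} → F₁ (g ∘ f) ≡ F₁ g ∘ F₁ f

record StrongFunctor {o ℓ} (C : CCC o ℓ) : Set (o ⊔ ℓ) where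
  open CCC C
  field
    functor : Endofunctor C
  open Endofunctor functor public
  field
    st : ∀ {X Y} → Hom (X × F₀ Y) (F₀ (X × Y))
    st-natural : ∀ {X X' Y Y'} {f : Hom X X'} {g : Hom Y Y'} →
                 st ∘ (f ⁂ F₁ g) ≡ F₁ (f ⁂ g) ∘ st
    st-unit : ∀ {Y} → F₁ π₂ ∘ st {⊤} {Y} ≡ π₂
    st-assoc : ∀ {X Y Z} →
               st {X × Y} {Z} ≡ F₁ assocˡ ∘ st ∘ (id ⁂ st) ∘ assocʳ

record StrongMonad {o ℓ} (C : CCC o ℓ) : Set (o ⊔ ℓ) where
  open CCC C
  field
    strongFunctor : StrongFunctor C
  open StrongFunctor strongFunctor public
  field
    η : ∀ {X} → Hom X (F₀ X)
    μ : ∀ {X} → Hom (F₀ (F₀ X)) (F₀ X)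
    η-natural : ∀ {X Y} {f : Hom X Y} → F₁ f ∘ η ≡ η ∘ f
    μ-natural : ∀ {X Y} {f : Hom X Y} → F₁ f ∘ μ ≡ μ ∘ F₁ (F₁ f)
    μ-assoc : ∀ {X} → μ {X} ∘ F₁ μ ≡ μ ∘ μ
    μ-unitˡ : ∀ {X} → μ {X} ∘ F₁ η ≡ id
    μ-unitʳ : ∀ {X} → μ {X} ∘ η ≡ id
    st-η : ∀ {X Y} → st {X} {Y} ∘ (id ⁂ η) ≡ η
    st-μ : ∀ {X Y} → st {X} {Y} ∘ (id ⁂ μ) ≡ μ ∘ F₁ st ∘ st

record OrderedObject {o ℓ} (C : CCC o ℓ) (Ω : CCC.Obj C) : Set (o ⊔ lsuc ℓ) where
  open CCC C
  infix 4 _≤_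
  field
    _≤_ : ∀ {X} → Hom X Ω → Hom X Ω → Set ℓ
    ≤-refl : ∀ {X} {f : Hom X Ω} → f ≤ f
    ≤-trans : ∀ {X} {f g h : Hom X Ω} → f ≤ g → g ≤ h → f ≤ h
    ≤-antisym : ∀ {X} {f g : Hom X Ω} → f ≤ g → g ≤ f → f ≡ g
    ⋁ : ∀ {X} {J : Set ℓ} → (J → Hom X Ω) → Hom X Ω
    ⋁-upper : ∀ {X} {J : Set ℓ} (f : J → Hom X Ω) (j : J) → f j ≤ ⋁ f
    ⋁-least : ∀ {X} {J : Set ℓ} (f : J → Hom X Ω) (g : Hom X Ω) →
              (∀ j → f j ≤ g) → ⋁ f ≤ g
    ⋁-∘ : ∀ {X Y} {J : Set ℓ} (f : J → Hom X Ω) (h : Hom Y X) →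
          ⋁ f ∘ h ≡ ⋁ (λ j → f j ∘ h)

  ⊥Ω : ∀ {X} → Hom X Ω
  ⊥Ω = ⋁ {J = Lift ℓ ⊥} (λ ())

record MonotoneAlgebra {o ℓ} (C : CCC o ℓ) (T : StrongMonad C) (F : StrongFunctor C)
                       {Ω : CCC.Obj C} (Ωo : OrderedObject C Ω) : Set (o ⊔ ℓ) where
  open CCC C
  open OrderedObject Ωo
  private
    module T = StrongMonad T
    module F = StrongFunctor F
  field
    τ : Hom (F.F₀ (T.F₀ Ω)) Ω
    τ-monotone : ∀ {X} {g g' : Hom X Ω} → g ≤ g' →
                 τ ∘ F.F₁ (T.F₁ g) ≤ τ ∘ F.F₁ (T.F₁ g')

module Semantics {o ℓ} (C : CCC o ℓ) (T : StrongMonad C) (F : StrongFunctor C)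
                 (A : CCC.Obj C) {Ω : CCC.Obj C} (Ωo : OrderedObject C Ω)
                 (alg : MonotoneAlgebra C T F Ωo) where
  open CCC C
  open OrderedObject Ωo
  open MonotoneAlgebra alg
  private
    module T = StrongMonad T
    module F = StrongFunctor F

  FT₀ : Obj → Obj
  FT₀ X = F.F₀ (T.F₀ X)

  FT₁ : ∀ {X Y} → Hom X Y → Hom (FT₀ X) (FT₀ Y)
  FT₁ f = F.F₁ (T.F₁ f)

  stFT : ∀ {X Y} → Hom (X × FT₀ Y) (FT₀ (X × Y))
  stFT = F.F₁ T.st ∘ F.st

  stFTʳ : ∀ {X Y} → Hom (FT₀ X × Y) (FT₀ (X × Y))
  stFTʳ = FT₁ swap ∘ stFT ∘ swap

  Φ : ∀ {X} → Hom X (FT₀ X) → Hom X Ω → Hom X Ω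
  Φ e g = τ ∘ FT₁ g ∘ e

  iter : ∀ {a} {B : Set a} → ℕ → (B → B) → B → B
  iter zero f x = x
  iter (suc n) f x = f (iter n f x)

  Pow : Obj → ℕ → Obj
  Pow X zero = ⊤
  Pow X (suc n) = Pow X n × X

  Seq : Obj → Obj
  Seq X = ∐ (Pow X)

  Seq⁺ : Obj → Obj
  Seq⁺ X = ∐ (λ n → Pow X (suc n))

  mapPow : ∀ {X Y} → Hom X Y → (n : ℕ) → Hom (Pow X n) (Pow Y n)
  mapPow f zero = !
  mapPow f (suc n) = mapPow f n ⁂ f

  map⁺ : ∀ {X Y} → Hom X Y → Hom (Seq⁺ X) (Seq⁺ Y)
  map⁺ {X} {Y} f = ⟪ (λ n → ι {λ m → Pow Y (suc m)} n ∘ mapPow f (suc n)) ⟫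

  nil : ∀ {X} → Hom X (Seq⁺ X)
  nil {X} = ι {λ m → Pow X (suc m)} 0 ∘ ⟨ ! , id ⟩

  last : ∀ {X} → Hom (Seq⁺ X) X
  last = ⟪ (λ n → π₂) ⟫

  -- ext : X^+ × X → X^+ (append an element)
  ext : ∀ {X} → Hom (Seq⁺ X × X) (Seq⁺ X)
  ext {X} = eval ∘ (⟪ (λ n → curry (ι {λ m → Pow X (suc m)} (suc n))) ⟫ ⁂ id)

  consPow : ∀ {X} (n : ℕ) → Hom (X × Pow X n) (Pow X (suc n))
  consPow zero = ⟨ ! , π₁ ⟩
  consPow (suc n) = ⟨ consPow n ∘ (id ⁂ π₁) , π₂ ∘ π₂ ⟩

  cons : ∀ {X} → Hom (X × Seq X) (Seq⁺ X)
  cons {X} = eval ∘ (⟪ (λ n → curry (ι {λ m → Pow X (suc m)} n ∘ consPow n ∘ swap)) ⟫ ⁂ id) ∘ swap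

  -- inclusion O^+ → O^*, and A^{O^*} ≅ A × A^{O^+} (forward direction)
  incl : ∀ {X} → Hom (Seq⁺ X) (Seq X)
  incl {X} = ⟪ (λ n → ι {Pow X} (suc n)) ⟫

  split : ∀ {X} → Hom (A ^ Seq X) (A × (A ^ Seq⁺ X))
  split {X} = ⟨ eval ∘ ⟨ id , ι {Pow X} 0 ∘ ! ⟩ , curry (eval ∘ (id ⁂ incl)) ⟩

  evO : ∀ {O} → Hom (O × (A ^ Seq⁺ O)) (A ^ Seq O)
  evO = curry (eval ∘ ⟨ π₂ ∘ π₁ , cons ∘ ⟨ π₁ ∘ π₁ , π₂ ⟩ ⟩)

  POCoalg : Obj → Obj → Obj
  POCoalg X P = (FT₀ X ^ A) × P

  restrict : ∀ {X P} → Hom X (POCoalg X P) → Hom P A → Hom X (FT₀ X)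
  restrict e u = eval ∘ ⟨ π₁ ∘ e , u ∘ (π₂ ∘ e) ⟩

  module _ {S O : Obj} (c : Hom S (POCoalg S O)) where
    δ : Hom S (FT₀ S ^ A)
    δ = π₁ ∘ c

    obs : Hom S O
    obs = π₂ ∘ c

    δ† : Hom (S × A) (FT₀ S)
    δ† = eval ∘ (δ ⁂ id)

    Sch : Hom (S × (A ^ Seq O)) (FT₀ (S × (A ^ Seq O)))
    Sch = FT₁ ⟨ π₁ , evO ∘ (obs ⁂ id) ⟩ ∘ stFTʳ ∘ (δ† ⁂ id) ∘ assocˡ ∘ (id ⁂ split)

    histh : Hom (Seq⁺ S) (FT₀ (Seq⁺ S) ^ A)
    histh = curry (FT₁ ext ∘ eval)
          ∘ curry (stFT ∘ (id ⁂ eval) ∘ assocʳ)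
          ∘ ⟨ id , δ ∘ last ⟩

    Hist : Hom (Seq⁺ S) (POCoalg (Seq⁺ S) (Seq⁺ O))
    Hist = ⟨ histh , map⁺ obs ⟩

    V : ∀ {I} → Hom I S → Hom I Ω
    V i = ⋁ {J = P.Σ (Hom (Seq⁺ O) A) (λ _ → ℕ)}
            (λ { (u P., n) → iter n (Φ Sch) ⊥Ω ∘ ⟨ id , curry (u ∘ cons) ∘ obs ⟩ ∘ i })

    H : ∀ {I} → Hom I S → Hom I Ω
    H i = ⋁ {J = P.Σ (Hom (Seq⁺ O) A) (λ _ → ℕ)}
            (λ { (u P., n) → iter n (Φ (restrict Hist u)) ⊥Ω ∘ nil ∘ i })

-- A history ŝ ∈ S⁺ determines its last state and, for a scheduler u : O⁺ → A, the residual
-- scheduler w ↦ u (obs⁺ ŝ ++ w). This map S⁺ → S × A^{O*} is an FT-coalgebra morphism from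
-- Hist(c)_u to Sch(c) taking nil s to (s, (u ∘ cons)† (obs s)). Iterates of Φ from ⊥ are natural
-- along coalgebra morphisms, so V(i,c) and H(i,c) are joins of the same family.
module Submission where

open import Level using (Level; lift)
open import Data.Nat using (ℕ; zero; suc)
open import Data.Product using (_,_)
open import Relation.Binary.PropositionalEquality
  using (_≡_; refl; sym; trans; cong; cong₂; module ≡-Reasoning)
open import Defs

module CartesianClosed {o ℓ} (C : CCC o ℓ) where
  open CCC C
  open ≡-Reasoning

  private variable
    U V W X Y Z : Obj

  pullˡ : {a : Hom Y Z} {b : Hom X Y} {c : Hom X Z} {f : Hom W X} →
          a ∘ b ≡ c → a ∘ (b ∘ f) ≡ c ∘ f
  pullˡ {f = f} p = trans (sym assoc) (cong (_∘ f) p)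

  pullʳ : {a : Hom Y Z} {b : Hom X Y} {c : Hom W Y} {f : Hom W X} →
          b ∘ f ≡ c → (a ∘ b) ∘ f ≡ a ∘ c
  pullʳ {a = a} p = trans assoc (cong (a ∘_) p)

  ⟨⟩∘ : {f : Hom W X} {g : Hom W Y} {h : Hom V W} → ⟨ f , g ⟩ ∘ h ≡ ⟨ f ∘ h , g ∘ h ⟩
  ⟨⟩∘ = ⟨⟩-unique (pullˡ π₁-⟨⟩) (pullˡ π₂-⟨⟩)

  ⟨⟩-η : {h : Hom W (X × Y)} → ⟨ π₁ ∘ h , π₂ ∘ h ⟩ ≡ h
  ⟨⟩-η = sym (⟨⟩-unique refl refl)

  ⟨π₁,π₂⟩ : ⟨ π₁ , π₂ ⟩ ≡ id {X × Y}
  ⟨π₁,π₂⟩ = sym (⟨⟩-unique identityʳ identityʳ)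

  ⁂∘⟨⟩ : {f : Hom X Y} {g : Hom W Z} {h : Hom V X} {k : Hom V W} →
         (f ⁂ g) ∘ ⟨ h , k ⟩ ≡ ⟨ f ∘ h , g ∘ k ⟩
  ⁂∘⟨⟩ = trans ⟨⟩∘ (cong₂ ⟨_,_⟩ (pullʳ π₁-⟨⟩) (pullʳ π₂-⟨⟩))

  swap∘⟨⟩ : {f : Hom V X} {g : Hom V Y} → swap ∘ ⟨ f , g ⟩ ≡ ⟨ g , f ⟩
  swap∘⟨⟩ = trans ⟨⟩∘ (cong₂ ⟨_,_⟩ π₂-⟨⟩ π₁-⟨⟩)

  swap∘swap : swap ∘ swap ≡ id {X × Y}
  swap∘swap = trans swap∘⟨⟩ ⟨π₁,π₂⟩

  assocʳ∘⟨⟩ : {f : Hom V X} {g : Hom V Y} {h : Hom V Z} →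
              assocʳ ∘ ⟨ ⟨ f , g ⟩ , h ⟩ ≡ ⟨ f , ⟨ g , h ⟩ ⟩
  assocʳ∘⟨⟩ = trans ⟨⟩∘ (cong₂ ⟨_,_⟩ (trans (pullʳ π₁-⟨⟩) π₁-⟨⟩)
                (trans ⟨⟩∘ (cong₂ ⟨_,_⟩ (trans (pullʳ π₁-⟨⟩) π₂-⟨⟩) π₂-⟨⟩)))

  assocˡ∘⟨⟩ : {f : Hom V X} {g : Hom V Y} {h : Hom V Z} →
              assocˡ ∘ ⟨ f , ⟨ g , h ⟩ ⟩ ≡ ⟨ ⟨ f , g ⟩ , h ⟩
  assocˡ∘⟨⟩ = trans ⟨⟩∘ (cong₂ ⟨_,_⟩
                (trans ⟨⟩∘ (cong₂ ⟨_,_⟩ π₁-⟨⟩ (trans (pullʳ π₂-⟨⟩) π₁-⟨⟩)))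
                (trans (pullʳ π₂-⟨⟩) π₂-⟨⟩))

  !-unique₂ : {f g : Hom X ⊤} → f ≡ g
  !-unique₂ {f = f} {g} = trans (!-unique f) (sym (!-unique g))

  eval∘⟨curry⟩ : {f : Hom (X × Y) Z} {h : Hom V X} {k : Hom V Y} →
                 eval ∘ ⟨ curry f ∘ h , k ⟩ ≡ f ∘ ⟨ h , k ⟩
  eval∘⟨curry⟩ {f = f} {h} {k} = begin
    eval ∘ ⟨ curry f ∘ h , k ⟩
      ≡⟨ cong (eval ∘_) (sym (trans ⟨⟩∘ (cong₂ ⟨_,_⟩ (pullʳ π₁-⟨⟩) π₂-⟨⟩))) ⟩
    eval ∘ (⟨ curry f ∘ π₁ , π₂ ⟩ ∘ ⟨ h , k ⟩)
      ≡⟨ pullˡ eval-curry ⟩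
    f ∘ ⟨ h , k ⟩ ∎

  transpose-ext : {f g : Hom X (Z ^ Y)} →
                  eval ∘ ⟨ f ∘ π₁ , π₂ ⟩ ≡ eval ∘ ⟨ g ∘ π₁ , π₂ ⟩ → f ≡ g
  transpose-ext p = trans (curry-unique p) (sym (curry-unique refl))

  curry∘ : {f : Hom (X × Y) Z} {h : Hom V X} → curry f ∘ h ≡ curry (f ∘ ⟨ h ∘ π₁ , π₂ ⟩)
  curry∘ = curry-unique (trans (cong (λ g → eval ∘ ⟨ g , π₂ ⟩) assoc) eval∘⟨curry⟩)

  curry-injective : {f g : Hom (X × Y) Z} → curry f ≡ curry g → f ≡ g
  curry-injective {f = f} {g} p =
    trans (sym eval-curry) (trans (cong (λ h → eval ∘ ⟨ h ∘ π₁ , π₂ ⟩) p) eval-curry)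

  ∐-ext : {Y : ℕ → Obj} {f g : Hom (∐ Y) Z} → (∀ n → f ∘ ι n ≡ g ∘ ι n) → f ≡ g
  ∐-ext {g = g} p = trans (⟪⟫-unique p) (sym (⟪⟫-unique {f = λ n → g ∘ ι n} (λ _ → refl)))

  -- Binary products distribute over the countable coproduct because (_ × X) has a right adjoint.
  ∐×-ext : {Y : ℕ → Obj} {f g : Hom (∐ Y × X) Z} →
           (∀ n → f ∘ ⟨ ι n ∘ π₁ , π₂ ⟩ ≡ g ∘ ⟨ ι n ∘ π₁ , π₂ ⟩) → f ≡ g
  ∐×-ext p = curry-injective (∐-ext λ n → trans curry∘ (trans (cong curry (p n)) (sym curry∘)))

  ×∐-ext : {Y : ℕ → Obj} {f g : Hom (X × ∐ Y) Z} →
           (∀ n → f ∘ ⟨ π₁ , ι n ∘ π₂ ⟩ ≡ g ∘ ⟨ π₁ , ι n ∘ π₂ ⟩) → f ≡ g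
  ×∐-ext {f = f} {g} p = begin
    f
      ≡⟨ sym swap-cancel ⟩
    (f ∘ swap) ∘ swap  ≡⟨ cong (_∘ swap) (∐×-ext λ n →
                            trans (swapped {h = f}) (trans (cong (_∘ swap) (p n)) (sym (swapped {h = g})))) ⟩
    (g ∘ swap) ∘ swap
      ≡⟨ swap-cancel ⟩
    g ∎
    where
      swap-cancel : {h : Hom (X × _) Z} → (h ∘ swap) ∘ swap ≡ h
      swap-cancel = trans assoc (trans (cong (_ ∘_) swap∘swap) identityʳ)
      swapped : ∀ {n} {h : Hom (X × _) Z} →
                (h ∘ swap) ∘ ⟨ ι n ∘ π₁ , π₂ ⟩ ≡ (h ∘ ⟨ π₁ , ι n ∘ π₂ ⟩) ∘ swap
      swapped {h = h} = trans (pullʳ swap∘⟨⟩)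
        (trans (cong (h ∘_) (sym (trans ⟨⟩∘ (cong₂ ⟨_,_⟩ π₁-⟨⟩ (pullʳ π₂-⟨⟩))))) (sym assoc))

  eval-⟪⟫-ι : {Y : ℕ → Obj} {h : (n : ℕ) → Hom (Y n) (Z ^ X)} {n : ℕ}
              {a : Hom V (Y n)} {b : Hom V X} →
              (eval ∘ (⟪ h ⟫ ⁂ id)) ∘ ⟨ ι n ∘ a , b ⟩ ≡ eval ∘ ⟨ h n ∘ a , b ⟩
  eval-⟪⟫-ι {n = n} =
    trans (pullʳ ⁂∘⟨⟩) (cong₂ (λ f g → eval ∘ ⟨ f , g ⟩) (pullˡ (⟪⟫-ι n)) identityˡ)

  eval-⟪⟫-ιʳ : {Y : ℕ → Obj} {h : (n : ℕ) → Hom (Y n) (Z ^ X)} {n : ℕ}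
               {a : Hom V X} {b : Hom V (Y n)} →
               (eval ∘ (⟪ h ⟫ ⁂ id) ∘ swap) ∘ ⟨ a , ι n ∘ b ⟩ ≡ eval ∘ ⟨ h n ∘ b , a ⟩
  eval-⟪⟫-ιʳ = trans (pullʳ (pullʳ swap∘⟨⟩)) (trans (sym assoc) eval-⟪⟫-ι)

module OrderedObjectProperties {o ℓ} (C : CCC o ℓ) {Ω : CCC.Obj C} (Ωo : OrderedObject C Ω) where
  open CCC C
  open OrderedObject Ωo

  private variable
    X Y : Obj

  ≤-reflexive : {f g : Hom X Ω} → f ≡ g → f ≤ g
  ≤-reflexive refl = ≤-refl

  ⋁-cong : {J : Set ℓ} {f g : J → Hom X Ω} → (∀ j → f j ≡ g j) → ⋁ f ≡ ⋁ g
  ⋁-cong {f = f} {g} p = ≤-antisym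
    (⋁-least f (⋁ g) λ j → ≤-trans (≤-reflexive (p j)) (⋁-upper g j))
    (⋁-least g (⋁ f) λ j → ≤-trans (≤-reflexive (sym (p j))) (⋁-upper f j))

  ⊥Ω∘ : {h : Hom Y X} → ⊥Ω ∘ h ≡ ⊥Ω
  ⊥Ω∘ {h = h} = trans (⋁-∘ _ h) (⋁-cong λ { (lift ()) })

module Sequences {o ℓ} (C : CCC o ℓ) (T : StrongMonad C) (F : StrongFunctor C)
    (A : CCC.Obj C) {Ω : CCC.Obj C} (Ωo : OrderedObject C Ω) (alg : MonotoneAlgebra C T F Ωo) where
  open CCC C
  open CartesianClosed C
  open Semantics C T F A Ωo alg
  open ≡-Reasoning

  private variable
    U W X Y Z : Obj

  ι⁺ : (n : ℕ) → Hom (Pow X (suc n)) (Seq⁺ X)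
  ι⁺ {X} = ι {λ m → Pow X (suc m)}

  ι* : (n : ℕ) → Hom (Pow X n) (Seq X)
  ι* {X} = ι {Pow X}

  ext∘⟨ι⁺⟩ : ∀ {n} {a : Hom U (Pow X (suc n))} {b : Hom U X} →
             ext ∘ ⟨ ι⁺ n ∘ a , b ⟩ ≡ ι⁺ (suc n) ∘ ⟨ a , b ⟩
  ext∘⟨ι⁺⟩ = trans eval-⟪⟫-ι eval∘⟨curry⟩

  cons∘⟨ι*⟩ : ∀ {n} {a : Hom U X} {w : Hom U (Pow X n)} →
              cons ∘ ⟨ a , ι* n ∘ w ⟩ ≡ ι⁺ n ∘ consPow n ∘ ⟨ a , w ⟩
  cons∘⟨ι*⟩ = trans eval-⟪⟫-ιʳ (trans eval∘⟨curry⟩ (pullʳ (pullʳ swap∘⟨⟩)))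

  init-last∘⟨⟩ : {f : Hom (X × Y) Z} {x : Hom U X} {w : Hom U (Y × W)} →
                 ⟨ f ∘ (id ⁂ π₁) , π₂ ∘ π₂ ⟩ ∘ ⟨ x , w ⟩ ≡ ⟨ f ∘ ⟨ x , π₁ ∘ w ⟩ , π₂ ∘ w ⟩
  init-last∘⟨⟩ =
    trans ⟨⟩∘ (cong₂ ⟨_,_⟩ (pullʳ (trans ⁂∘⟨⟩ (cong₂ ⟨_,_⟩ identityˡ refl))) (pullʳ π₂-⟨⟩))

  incl∘cons∘⟨ι*⟩ : ∀ {n} {a : Hom U X} {w : Hom U (Pow X n)} →
                   incl ∘ cons ∘ ⟨ a , ι* n ∘ w ⟩ ≡ ι* (suc n) ∘ consPow n ∘ ⟨ a , w ⟩
  incl∘cons∘⟨ι*⟩ {n = n} = trans (cong (incl ∘_) cons∘⟨ι*⟩) (pullˡ (⟪⟫-ι n))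

  appendPow : (m : ℕ) → Hom (Seq⁺ X × Pow X m) (Seq⁺ X)
  appendPow zero = π₁
  appendPow (suc m) = ext ∘ ⟨ appendPow m ∘ (id ⁂ π₁) , π₂ ∘ π₂ ⟩

  appendPow-suc : ∀ m {x : Hom U (Seq⁺ X)} {w : Hom U (Pow X (suc m))} →
                  appendPow (suc m) ∘ ⟨ x , w ⟩ ≡ ext ∘ ⟨ appendPow m ∘ ⟨ x , π₁ ∘ w ⟩ , π₂ ∘ w ⟩
  appendPow-suc m = pullʳ init-last∘⟨⟩

  appendPow-nil : ∀ m {a : Hom U X} {w : Hom U (Pow X m)} →
                  appendPow m ∘ ⟨ nil ∘ a , w ⟩ ≡ ι⁺ m ∘ consPow m ∘ ⟨ a , w ⟩
  appendPow-nil zero {a} {w} = begin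
    π₁ ∘ ⟨ nil ∘ a , w ⟩
      ≡⟨ trans π₁-⟨⟩ (pullʳ ⟨⟩∘) ⟩
    ι⁺ 0 ∘ ⟨ ! ∘ a , id ∘ a ⟩
      ≡⟨ cong (ι⁺ 0 ∘_) (sym (trans ⟨⟩∘ (cong₂ ⟨_,_⟩ !-unique₂ (trans π₁-⟨⟩ (sym identityˡ))))) ⟩
    ι⁺ 0 ∘ consPow 0 ∘ ⟨ a , w ⟩ ∎
  appendPow-nil (suc m) {a} {w} = begin
    appendPow (suc m) ∘ ⟨ nil ∘ a , w ⟩
      ≡⟨ appendPow-suc m ⟩
    ext ∘ ⟨ appendPow m ∘ ⟨ nil ∘ a , π₁ ∘ w ⟩ , π₂ ∘ w ⟩
      ≡⟨ cong (λ p → ext ∘ ⟨ p , π₂ ∘ w ⟩) (appendPow-nil m) ⟩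
    ext ∘ ⟨ ι⁺ m ∘ consPow m ∘ ⟨ a , π₁ ∘ w ⟩ , π₂ ∘ w ⟩
      ≡⟨ ext∘⟨ι⁺⟩ ⟩
    ι⁺ (suc m) ∘ ⟨ consPow m ∘ ⟨ a , π₁ ∘ w ⟩ , π₂ ∘ w ⟩
      ≡⟨ cong (ι⁺ (suc m) ∘_) (sym init-last∘⟨⟩) ⟩
    ι⁺ (suc m) ∘ consPow (suc m) ∘ ⟨ a , w ⟩ ∎

  appendPow-ext : ∀ m {x : Hom U (Seq⁺ X)} {a : Hom U X} {w : Hom U (Pow X m)} →
                  appendPow m ∘ ⟨ ext ∘ ⟨ x , a ⟩ , w ⟩ ≡ appendPow (suc m) ∘ ⟨ x , consPow m ∘ ⟨ a , w ⟩ ⟩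
  appendPow-ext {U = U} {X = X} zero {x} {a} {w} = begin
    π₁ ∘ ⟨ ext ∘ ⟨ x , a ⟩ , w ⟩
      ≡⟨ π₁-⟨⟩ ⟩
    ext ∘ ⟨ x , a ⟩
      ≡⟨ sym (cong₂ (λ p q → ext ∘ ⟨ p , q ⟩) π₁-⟨⟩ (trans (pullˡ π₂-⟨⟩) π₁-⟨⟩)) ⟩
    ext ∘ ⟨ π₁ ∘ ⟨ x , π₁ ∘ c ⟩ , π₂ ∘ c ⟩
      ≡⟨ sym (appendPow-suc 0) ⟩
    appendPow 1 ∘ ⟨ x , c ⟩ ∎
    where
      c : Hom U (Pow X 1)
      c = consPow 0 ∘ ⟨ a , w ⟩
  appendPow-ext {U = U} {X = X} (suc m) {x} {a} {w} = begin
    appendPow (suc m) ∘ ⟨ ext ∘ ⟨ x , a ⟩ , w ⟩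
      ≡⟨ appendPow-suc m ⟩
    ext ∘ ⟨ appendPow m ∘ ⟨ ext ∘ ⟨ x , a ⟩ , π₁ ∘ w ⟩ , π₂ ∘ w ⟩
      ≡⟨ cong (λ p → ext ∘ ⟨ p , π₂ ∘ w ⟩) (appendPow-ext m) ⟩
    ext ∘ ⟨ appendPow (suc m) ∘ ⟨ x , consPow m ∘ ⟨ a , π₁ ∘ w ⟩ ⟩ , π₂ ∘ w ⟩
      ≡⟨ sym (cong₂ (λ p q → ext ∘ ⟨ appendPow (suc m) ∘ ⟨ x , p ⟩ , q ⟩)
                    (trans (cong (π₁ ∘_) init-last∘⟨⟩) π₁-⟨⟩) (trans (cong (π₂ ∘_) init-last∘⟨⟩) π₂-⟨⟩)) ⟩
    ext ∘ ⟨ appendPow (suc m) ∘ ⟨ x , π₁ ∘ c ⟩ , π₂ ∘ c ⟩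
      ≡⟨ sym (appendPow-suc (suc m)) ⟩
    appendPow (suc (suc m)) ∘ ⟨ x , c ⟩ ∎
    where
      c : Hom U (Pow X (suc (suc m)))
      c = consPow (suc m) ∘ ⟨ a , w ⟩

  append : Hom (Seq⁺ X × Seq X) (Seq⁺ X)
  append = eval ∘ (⟪ (λ m → curry (appendPow m ∘ swap)) ⟫ ⁂ id) ∘ swap

  append∘⟨ι*⟩ : ∀ {m} {x : Hom U (Seq⁺ X)} {w : Hom U (Pow X m)} →
                append ∘ ⟨ x , ι* m ∘ w ⟩ ≡ appendPow m ∘ ⟨ x , w ⟩
  append∘⟨ι*⟩ = trans eval-⟪⟫-ιʳ (trans eval∘⟨curry⟩ (pullʳ swap∘⟨⟩))

  append-ε : {x : Hom U (Seq⁺ X)} → append ∘ ⟨ x , ι* 0 ∘ ! ⟩ ≡ x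
  append-ε = trans append∘⟨ι*⟩ π₁-⟨⟩

  append-nil : append ∘ ⟨ nil ∘ π₁ , π₂ ⟩ ≡ cons {X}
  append-nil = ×∐-ext λ n → begin
    (append ∘ ⟨ nil ∘ π₁ , π₂ ⟩) ∘ ⟨ π₁ , ι* n ∘ π₂ ⟩
      ≡⟨ pullʳ (trans ⟨⟩∘ (cong₂ ⟨_,_⟩ (pullʳ π₁-⟨⟩) π₂-⟨⟩)) ⟩
    append ∘ ⟨ nil ∘ π₁ , ι* n ∘ π₂ ⟩
      ≡⟨ append∘⟨ι*⟩ ⟩
    appendPow n ∘ ⟨ nil ∘ π₁ , π₂ ⟩
      ≡⟨ appendPow-nil n ⟩
    ι⁺ n ∘ consPow n ∘ ⟨ π₁ , π₂ ⟩
      ≡⟨ sym cons∘⟨ι*⟩ ⟩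
    cons ∘ ⟨ π₁ , ι* n ∘ π₂ ⟩ ∎

  append-ext : append ∘ ⟨ ext ∘ π₁ , π₂ ⟩ ≡ append ∘ ⟨ π₁ ∘ π₁ , incl ∘ cons {X} ∘ ⟨ π₂ ∘ π₁ , π₂ ⟩ ⟩
  append-ext = ×∐-ext λ n → begin
    (append ∘ ⟨ ext ∘ π₁ , π₂ ⟩) ∘ ⟨ π₁ , ι* n ∘ π₂ ⟩
      ≡⟨ pullʳ (trans ⟨⟩∘ (cong₂ ⟨_,_⟩ (pullʳ π₁-⟨⟩) π₂-⟨⟩)) ⟩
    append ∘ ⟨ ext ∘ π₁ , ι* n ∘ π₂ ⟩
      ≡⟨ append∘⟨ι*⟩ ⟩
    appendPow n ∘ ⟨ ext ∘ π₁ , π₂ ⟩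
      ≡⟨ cong (λ p → appendPow n ∘ ⟨ ext ∘ p , π₂ ⟩) (sym ⟨⟩-η) ⟩
    appendPow n ∘ ⟨ ext ∘ ⟨ π₁ ∘ π₁ , π₂ ∘ π₁ ⟩ , π₂ ⟩
      ≡⟨ appendPow-ext n ⟩
    appendPow (suc n) ∘ ⟨ π₁ ∘ π₁ , consPow n ∘ ⟨ π₂ ∘ π₁ , π₂ ⟩ ⟩
      ≡⟨ sym append∘⟨ι*⟩ ⟩
    append ∘ ⟨ π₁ ∘ π₁ , ι* (suc n) ∘ consPow n ∘ ⟨ π₂ ∘ π₁ , π₂ ⟩ ⟩
      ≡⟨ cong (λ p → append ∘ ⟨ π₁ ∘ π₁ , p ⟩) (sym incl∘cons∘⟨ι*⟩) ⟩
    append ∘ ⟨ π₁ ∘ π₁ , incl ∘ cons ∘ ⟨ π₂ ∘ π₁ , ι* n ∘ π₂ ⟩ ⟩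
      ≡⟨ sym (pullʳ (trans ⟨⟩∘ (cong₂ ⟨_,_⟩ (pullʳ π₁-⟨⟩)
                (pullʳ (pullʳ (trans ⟨⟩∘ (cong₂ ⟨_,_⟩ (pullʳ π₁-⟨⟩) π₂-⟨⟩))))))) ⟩
    (append ∘ ⟨ π₁ ∘ π₁ , incl ∘ cons ∘ ⟨ π₂ ∘ π₁ , π₂ ⟩ ⟩) ∘ ⟨ π₁ , ι* n ∘ π₂ ⟩ ∎

  last∘ext : last ∘ ext ≡ π₂ {Seq⁺ X} {X}
  last∘ext = ∐×-ext λ n →
    trans (pullʳ ext∘⟨ι⁺⟩) (trans (pullˡ (⟪⟫-ι (suc n))) (trans π₂-⟨⟩ (sym π₂-⟨⟩)))

  map⁺∘ext : {f : Hom X Y} → map⁺ f ∘ ext ≡ ext ∘ (map⁺ f ⁂ f)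
  map⁺∘ext {f = f} = ∐×-ext λ n → begin
    (map⁺ f ∘ ext) ∘ ⟨ ι⁺ n ∘ π₁ , π₂ ⟩
      ≡⟨ pullʳ ext∘⟨ι⁺⟩ ⟩
    map⁺ f ∘ ι⁺ (suc n) ∘ ⟨ π₁ , π₂ ⟩
      ≡⟨ pullˡ (⟪⟫-ι (suc n)) ⟩
    (ι⁺ (suc n) ∘ mapPow f (suc (suc n))) ∘ ⟨ π₁ , π₂ ⟩
      ≡⟨ pullʳ ⁂∘⟨⟩ ⟩
    ι⁺ (suc n) ∘ ⟨ mapPow f (suc n) ∘ π₁ , f ∘ π₂ ⟩
      ≡⟨ sym ext∘⟨ι⁺⟩ ⟩
    ext ∘ ⟨ ι⁺ n ∘ mapPow f (suc n) ∘ π₁ , f ∘ π₂ ⟩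
      ≡⟨ cong (λ p → ext ∘ ⟨ p , f ∘ π₂ ⟩) (sym (trans (pullˡ (⟪⟫-ι n)) assoc)) ⟩
    ext ∘ ⟨ map⁺ f ∘ ι⁺ n ∘ π₁ , f ∘ π₂ ⟩
      ≡⟨ sym (pullʳ ⁂∘⟨⟩) ⟩
    (ext ∘ (map⁺ f ⁂ f)) ∘ ⟨ ι⁺ n ∘ π₁ , π₂ ⟩ ∎

  map⁺∘nil : {f : Hom X Y} → map⁺ f ∘ nil ≡ nil ∘ f
  map⁺∘nil {f = f} = begin
    map⁺ f ∘ ι⁺ 0 ∘ ⟨ ! , id ⟩
      ≡⟨ pullˡ (⟪⟫-ι 0) ⟩
    (ι⁺ 0 ∘ mapPow f 1) ∘ ⟨ ! , id ⟩
      ≡⟨ pullʳ ⁂∘⟨⟩ ⟩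
    ι⁺ 0 ∘ ⟨ ! ∘ ! , f ∘ id ⟩
      ≡⟨ cong (ι⁺ 0 ∘_) (cong₂ ⟨_,_⟩ !-unique₂ (trans identityʳ (sym identityˡ))) ⟩
    ι⁺ 0 ∘ ⟨ ! ∘ f , id ∘ f ⟩
      ≡⟨ sym (pullʳ ⟨⟩∘) ⟩
    nil ∘ f ∎

  module _ {O : Obj} where

    atEmpty : Hom (A ^ Seq O) A
    atEmpty = eval ∘ ⟨ id , ι* 0 ∘ ! ⟩

    toNonempty : Hom (A ^ Seq O) (A ^ Seq⁺ O)
    toNonempty = curry (eval ∘ (id ⁂ incl))

    eval∘⟨toNonempty⟩ : {h : Hom U (A ^ Seq O)} {w : Hom U (Seq⁺ O)} →
                        eval ∘ ⟨ toNonempty ∘ h , w ⟩ ≡ eval ∘ ⟨ h , incl ∘ w ⟩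
    eval∘⟨toNonempty⟩ = trans eval∘⟨curry⟩ (pullʳ (trans ⁂∘⟨⟩ (cong₂ ⟨_,_⟩ identityˡ refl)))

    eval∘⟨evO⟩ : {a : Hom U O} {h : Hom U (A ^ Seq⁺ O)} {w : Hom U (Seq O)} →
                 eval ∘ ⟨ evO ∘ ⟨ a , h ⟩ , w ⟩ ≡ eval ∘ ⟨ h , cons ∘ ⟨ a , w ⟩ ⟩
    eval∘⟨evO⟩ = trans eval∘⟨curry⟩ (pullʳ (trans ⟨⟩∘ (cong₂ ⟨_,_⟩
      (trans (pullʳ π₁-⟨⟩) π₂-⟨⟩)
      (pullʳ (trans ⟨⟩∘ (cong₂ ⟨_,_⟩ (trans (pullʳ π₁-⟨⟩) π₁-⟨⟩) π₂-⟨⟩))))))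

    residual : Hom (Seq⁺ O) A → Hom (Seq⁺ O) (A ^ Seq O)
    residual u = curry (u ∘ append)

    atEmpty∘residual : {u : Hom (Seq⁺ O) A} → atEmpty ∘ residual u ≡ u
    atEmpty∘residual {u} = begin
      (eval ∘ ⟨ id , ι* 0 ∘ ! ⟩) ∘ residual u         ≡⟨ pullʳ ⟨⟩∘ ⟩
      eval ∘ ⟨ id ∘ residual u , (ι* 0 ∘ !) ∘ residual u ⟩
        ≡⟨ cong₂ (λ p q → eval ∘ ⟨ p , q ⟩) (trans identityˡ (sym identityʳ)) (pullʳ !-unique₂) ⟩
      eval ∘ ⟨ residual u ∘ id , ι* 0 ∘ ! ⟩            ≡⟨ eval∘⟨curry⟩ ⟩
      (u ∘ append) ∘ ⟨ id , ι* 0 ∘ ! ⟩                 ≡⟨ pullʳ append-ε ⟩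
      u ∘ id                                          ≡⟨ identityʳ ⟩
      u                                               ∎

    residual∘nil : {u : Hom (Seq⁺ O) A} → residual u ∘ nil ≡ curry (u ∘ cons)
    residual∘nil = trans curry∘ (cong curry (pullʳ append-nil))

    residual∘ext : {u : Hom (Seq⁺ O) A} →
                   residual u ∘ ext ≡ evO ∘ ⟨ π₂ , toNonempty ∘ residual u ∘ π₁ ⟩
    residual∘ext {u} = transpose-ext (begin
      eval ∘ ⟨ (residual u ∘ ext) ∘ π₁ , π₂ ⟩
        ≡⟨ cong (λ p → eval ∘ ⟨ p , π₂ ⟩) assoc ⟩
      eval ∘ ⟨ residual u ∘ ext ∘ π₁ , π₂ ⟩
        ≡⟨ eval∘⟨curry⟩ ⟩
      (u ∘ append) ∘ ⟨ ext ∘ π₁ , π₂ ⟩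
        ≡⟨ pullʳ append-ext ⟩
      u ∘ append ∘ ⟨ π₁ ∘ π₁ , incl ∘ cons ∘ ⟨ π₂ ∘ π₁ , π₂ ⟩ ⟩
        ≡⟨ sym (trans eval∘⟨curry⟩ assoc) ⟩
      eval ∘ ⟨ residual u ∘ π₁ ∘ π₁ , incl ∘ cons ∘ ⟨ π₂ ∘ π₁ , π₂ ⟩ ⟩
        ≡⟨ sym eval∘⟨toNonempty⟩ ⟩
      eval ∘ ⟨ toNonempty ∘ residual u ∘ π₁ ∘ π₁ , cons ∘ ⟨ π₂ ∘ π₁ , π₂ ⟩ ⟩
        ≡⟨ sym eval∘⟨evO⟩ ⟩
      eval ∘ ⟨ evO ∘ ⟨ π₂ ∘ π₁ , toNonempty ∘ residual u ∘ π₁ ∘ π₁ ⟩ , π₂ ⟩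
        ≡⟨ cong (λ p → eval ∘ ⟨ p , π₂ ⟩) (sym (pullʳ (trans ⟨⟩∘ (cong₂ ⟨_,_⟩ refl (pullʳ assoc))))) ⟩
      eval ∘ ⟨ (evO ∘ ⟨ π₂ , toNonempty ∘ residual u ∘ π₁ ⟩) ∘ π₁ , π₂ ⟩ ∎)

module CoalgebraMorphisms {o ℓ} (C : CCC o ℓ) (T : StrongMonad C) (F : StrongFunctor C)
    (A : CCC.Obj C) {Ω : CCC.Obj C} (Ωo : OrderedObject C Ω) (alg : MonotoneAlgebra C T F Ωo) where
  open CCC C
  open CartesianClosed C
  open Semantics C T F A Ωo alg
  open OrderedObject Ωo using (⊥Ω)
  open OrderedObjectProperties C Ωo
  open MonotoneAlgebra alg
  open ≡-Reasoning

  private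
    module T = StrongMonad T
    module F = StrongFunctor F
    variable
      X Y Z : Obj

  FT-id : FT₁ (id {X}) ≡ id
  FT-id = trans (cong F.F₁ T.F-id) F.F-id

  FT-∘ : {f : Hom X Y} {g : Hom Y Z} → FT₁ (g ∘ f) ≡ FT₁ g ∘ FT₁ f
  FT-∘ = trans (cong F.F₁ T.F-∘) F.F-∘

  stFT-natural : {f : Hom X Y} → stFT ∘ (f ⁂ id {FT₀ Z}) ≡ FT₁ (f ⁂ id) ∘ stFT
  stFT-natural {f = f} = begin
    (F.F₁ T.st ∘ F.st) ∘ (f ⁂ id)
      ≡⟨ cong (λ g → (F.F₁ T.st ∘ F.st) ∘ (f ⁂ g)) (sym FT-id) ⟩
    (F.F₁ T.st ∘ F.st) ∘ (f ⁂ F.F₁ (T.F₁ id))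
      ≡⟨ pullʳ F.st-natural ⟩
    F.F₁ T.st ∘ F.F₁ (f ⁂ T.F₁ id) ∘ F.st
      ≡⟨ pullˡ (trans (sym F.F-∘) (cong F.F₁ T.st-natural)) ⟩
    F.F₁ (T.F₁ (f ⁂ id) ∘ T.st) ∘ F.st
      ≡⟨ trans (cong (_∘ F.st) F.F-∘) assoc ⟩
    FT₁ (f ⁂ id) ∘ F.F₁ T.st ∘ F.st ∎

  Φ-natural : {e : Hom X (FT₀ X)} {e' : Hom Y (FT₀ Y)} {h : Hom Y X} →
              e ∘ h ≡ FT₁ h ∘ e' → ∀ g → Φ e g ∘ h ≡ Φ e' (g ∘ h)
  Φ-natural p g = trans (pullʳ (pullʳ p)) (cong (τ ∘_) (pullˡ (sym FT-∘)))

  iterate-Φ-natural : {e : Hom X (FT₀ X)} {e' : Hom Y (FT₀ Y)} {h : Hom Y X} →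
                      e ∘ h ≡ FT₁ h ∘ e' → ∀ n → iter n (Φ e) ⊥Ω ∘ h ≡ iter n (Φ e') ⊥Ω
  iterate-Φ-natural p zero = ⊥Ω∘
  iterate-Φ-natural {e' = e'} p (suc n) =
    trans (Φ-natural p _) (cong (Φ e') (iterate-Φ-natural p n))

module HistoryMorphism {o ℓ} (C : CCC o ℓ) (T : StrongMonad C) (F : StrongFunctor C)
    (A : CCC.Obj C) {Ω : CCC.Obj C} (Ωo : OrderedObject C Ω) (alg : MonotoneAlgebra C T F Ωo)
    {S O : CCC.Obj C} (c : CCC.Hom C S (Semantics.POCoalg C T F A Ωo alg S O)) where
  open CCC C
  open CartesianClosed C
  open Semantics C T F A Ωo alg
  open Sequences C T F A Ωo alg
  open CoalgebraMorphisms C T F A Ωo alg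
  open ≡-Reasoning

  private variable
    U : Obj

  δ†∘⟨⟩ : {s : Hom U S} {a : Hom U A} → δ† c ∘ ⟨ s , a ⟩ ≡ eval ∘ ⟨ δ c ∘ s , a ⟩
  δ†∘⟨⟩ = pullʳ (trans ⁂∘⟨⟩ (cong₂ ⟨_,_⟩ refl identityˡ))

  advance : Hom (S × (A ^ Seq⁺ O)) (S × (A ^ Seq O))
  advance = ⟨ π₁ , evO ∘ (obs c ⁂ id) ⟩

  Sch∘⟨⟩ : {s : Hom U S} {h : Hom U (A ^ Seq O)} →
           Sch c ∘ ⟨ s , h ⟩
           ≡ FT₁ (advance ∘ swap) ∘ stFT ∘ ⟨ toNonempty ∘ h , δ† c ∘ ⟨ s , atEmpty ∘ h ⟩ ⟩
  Sch∘⟨⟩ {s = s} {h} = begin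
    Sch c ∘ ⟨ s , h ⟩
      ≡⟨ pullʳ (pullʳ (pullʳ (pullʳ ⁂∘⟨⟩))) ⟩
    FT₁ advance ∘ stFTʳ ∘ (δ† c ⁂ id) ∘ assocˡ ∘ ⟨ id ∘ s , split ∘ h ⟩
      ≡⟨ cong (λ p → FT₁ advance ∘ stFTʳ ∘ (δ† c ⁂ id) ∘ p)
              (trans (cong₂ (λ p q → assocˡ ∘ ⟨ p , q ⟩) identityˡ ⟨⟩∘) assocˡ∘⟨⟩) ⟩
    FT₁ advance ∘ stFTʳ ∘ (δ† c ⁂ id) ∘ ⟨ ⟨ s , atEmpty ∘ h ⟩ , toNonempty ∘ h ⟩
      ≡⟨ cong (λ p → FT₁ advance ∘ stFTʳ ∘ p) (trans ⁂∘⟨⟩ (cong₂ ⟨_,_⟩ refl identityˡ)) ⟩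
    FT₁ advance ∘ stFTʳ ∘ ⟨ δ† c ∘ ⟨ s , atEmpty ∘ h ⟩ , toNonempty ∘ h ⟩
      ≡⟨ cong (FT₁ advance ∘_) (pullʳ (pullʳ swap∘⟨⟩)) ⟩
    FT₁ advance ∘ FT₁ swap ∘ stFT ∘ ⟨ toNonempty ∘ h , δ† c ∘ ⟨ s , atEmpty ∘ h ⟩ ⟩
      ≡⟨ pullˡ (sym FT-∘) ⟩
    FT₁ (advance ∘ swap) ∘ stFT ∘ ⟨ toNonempty ∘ h , δ† c ∘ ⟨ s , atEmpty ∘ h ⟩ ⟩ ∎

  restrict-Hist : {u : Hom (Seq⁺ O) A} →
                  restrict (Hist c) u ≡ FT₁ ext ∘ stFT ∘ ⟨ id , δ† c ∘ ⟨ last , u ∘ map⁺ (obs c) ⟩ ⟩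
  restrict-Hist {u} = begin
    eval ∘ ⟨ π₁ ∘ Hist c , u ∘ π₂ ∘ Hist c ⟩
      ≡⟨ cong₂ (λ p q → eval ∘ ⟨ p , u ∘ q ⟩) π₁-⟨⟩ π₂-⟨⟩ ⟩
    eval ∘ ⟨ curry (FT₁ ext ∘ eval) ∘ curry B ∘ ⟨ id , δ c ∘ last ⟩ , u ∘ map⁺ (obs c) ⟩
      ≡⟨ trans eval∘⟨curry⟩ (pullʳ eval∘⟨curry⟩) ⟩
    FT₁ ext ∘ B ∘ ⟨ ⟨ id , δ c ∘ last ⟩ , u ∘ map⁺ (obs c) ⟩
      ≡⟨ cong (FT₁ ext ∘_) (pullʳ (pullʳ assocʳ∘⟨⟩)) ⟩
    FT₁ ext ∘ stFT ∘ (id ⁂ eval) ∘ ⟨ id , ⟨ δ c ∘ last , u ∘ map⁺ (obs c) ⟩ ⟩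
      ≡⟨ cong (λ p → FT₁ ext ∘ stFT ∘ p) (trans ⁂∘⟨⟩ (cong₂ ⟨_,_⟩ identityˡ (sym δ†∘⟨⟩))) ⟩
    FT₁ ext ∘ stFT ∘ ⟨ id , δ† c ∘ ⟨ last , u ∘ map⁺ (obs c) ⟩ ⟩ ∎
    where
      B : Hom ((Seq⁺ S × (FT₀ S ^ A)) × A) (FT₀ (Seq⁺ S × S))
      B = stFT ∘ (id ⁂ eval) ∘ assocʳ

  module _ (u : Hom (Seq⁺ O) A) where

    strategy : Hom (Seq⁺ S) (A ^ Seq O)
    strategy = residual u ∘ map⁺ (obs c)

    toSch : Hom (Seq⁺ S) (S × (A ^ Seq O))
    toSch = ⟨ last , strategy ⟩

    atEmpty∘strategy : atEmpty ∘ strategy ≡ u ∘ map⁺ (obs c)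
    atEmpty∘strategy = pullˡ atEmpty∘residual

    strategy∘ext : strategy ∘ ext ≡ evO ∘ ⟨ obs c ∘ π₂ , toNonempty ∘ strategy ∘ π₁ ⟩
    strategy∘ext = begin
      (residual u ∘ map⁺ (obs c)) ∘ ext                                    ≡⟨ pullʳ map⁺∘ext ⟩
      residual u ∘ ext ∘ (map⁺ (obs c) ⁂ obs c)                             ≡⟨ pullˡ residual∘ext ⟩
      (evO ∘ ⟨ π₂ , toNonempty ∘ residual u ∘ π₁ ⟩) ∘ (map⁺ (obs c) ⁂ obs c)
        ≡⟨ pullʳ (trans ⟨⟩∘ (cong₂ ⟨_,_⟩ π₂-⟨⟩ (pullʳ (trans (pullʳ π₁-⟨⟩) (sym assoc))))) ⟩
      evO ∘ ⟨ obs c ∘ π₂ , toNonempty ∘ strategy ∘ π₁ ⟩                    ∎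

    toSch∘nil : toSch ∘ nil ≡ ⟨ id , curry (u ∘ cons) ∘ obs c ⟩
    toSch∘nil = trans ⟨⟩∘ (cong₂ ⟨_,_⟩
      (trans (pullˡ (⟪⟫-ι 0)) π₂-⟨⟩)
      (trans (pullʳ map⁺∘nil) (pullˡ residual∘nil)))

    toSch∘ext : toSch ∘ ext ≡ (advance ∘ swap) ∘ (toNonempty ∘ strategy ⁂ id)
    toSch∘ext = begin
      ⟨ last , strategy ⟩ ∘ ext
        ≡⟨ trans ⟨⟩∘ (cong₂ ⟨_,_⟩ last∘ext strategy∘ext) ⟩
      ⟨ π₂ , evO ∘ ⟨ obs c ∘ π₂ , toNonempty ∘ strategy ∘ π₁ ⟩ ⟩
        ≡⟨ sym (trans (pullʳ swap∘⟨⟩) (trans ⟨⟩∘ (cong₂ ⟨_,_⟩ (trans π₁-⟨⟩ identityˡ)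
             (pullʳ (trans ⁂∘⟨⟩ (cong₂ ⟨_,_⟩ (cong (obs c ∘_) identityˡ) (trans identityˡ assoc))))))) ⟩
      (advance ∘ swap) ∘ (toNonempty ∘ strategy ⁂ id) ∎

    toSch-morphism : Sch c ∘ toSch ≡ FT₁ toSch ∘ restrict (Hist c) u
    toSch-morphism = begin
      Sch c ∘ toSch
        ≡⟨ Sch∘⟨⟩ ⟩
      FT₁ (advance ∘ swap) ∘ stFT ∘ ⟨ r , δ† c ∘ ⟨ last , atEmpty ∘ strategy ⟩ ⟩
        ≡⟨ cong (λ p → FT₁ (advance ∘ swap) ∘ stFT ∘ ⟨ r , δ† c ∘ ⟨ last , p ⟩ ⟩) atEmpty∘strategy ⟩
      FT₁ (advance ∘ swap) ∘ stFT ∘ ⟨ r , step ⟩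
        ≡⟨ cong (λ p → FT₁ (advance ∘ swap) ∘ stFT ∘ p) (sym (trans ⁂∘⟨⟩ (cong₂ ⟨_,_⟩ identityʳ identityˡ))) ⟩
      FT₁ (advance ∘ swap) ∘ stFT ∘ (r ⁂ id) ∘ ⟨ id , step ⟩
        ≡⟨ cong (FT₁ (advance ∘ swap) ∘_) (trans (pullˡ stFT-natural) assoc) ⟩
      FT₁ (advance ∘ swap) ∘ FT₁ (r ⁂ id) ∘ stFT ∘ ⟨ id , step ⟩
        ≡⟨ pullˡ (trans (sym FT-∘) (cong FT₁ (sym toSch∘ext))) ⟩
      FT₁ (toSch ∘ ext) ∘ stFT ∘ ⟨ id , step ⟩
        ≡⟨ trans (cong (_∘ (stFT ∘ ⟨ id , step ⟩)) FT-∘) assoc ⟩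
      FT₁ toSch ∘ FT₁ ext ∘ stFT ∘ ⟨ id , step ⟩
        ≡⟨ cong (FT₁ toSch ∘_) (sym restrict-Hist) ⟩
      FT₁ toSch ∘ restrict (Hist c) u ∎
      where
        r : Hom (Seq⁺ S) (A ^ Seq⁺ O)
        r = toNonempty ∘ strategy
        step : Hom (Seq⁺ S) (FT₀ S)
        step = δ† c ∘ ⟨ last , u ∘ map⁺ (obs c) ⟩

proposition5p11 : ∀ {o ℓ : Level} (C : CCC o ℓ) (T : StrongMonad C) (F : StrongFunctor C)
    (A I : CCC.Obj C) {Ω : CCC.Obj C} (Ωo : OrderedObject C Ω)
    (alg : MonotoneAlgebra C T F Ωo)
    {S O : CCC.Obj C} (i : CCC.Hom C I S)
    (c : CCC.Hom C S (Semantics.POCoalg C T F A Ωo alg S O)) →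
    Semantics.V C T F A Ωo alg c i ≡ Semantics.H C T F A Ωo alg c i
proposition5p11 C T F A I Ωo alg i c = ⋁-cong λ { (u , n) → begin
    iter n (Φ (Sch c)) ⊥Ω ∘ ⟨ id , curry (u ∘ cons) ∘ obs c ⟩ ∘ i
      ≡⟨ cong (λ p → iter n (Φ (Sch c)) ⊥Ω ∘ p ∘ i) (sym (toSch∘nil u)) ⟩
    iter n (Φ (Sch c)) ⊥Ω ∘ (toSch u ∘ nil) ∘ i
      ≡⟨ trans (cong (iter n (Φ (Sch c)) ⊥Ω ∘_) assoc) (pullˡ (iterate-Φ-natural (toSch-morphism u) n)) ⟩
    iter n (Φ (restrict (Hist c) u)) ⊥Ω ∘ nil ∘ i ∎ }
  where
    open CCC C
    open CartesianClosed C
    open OrderedObject Ωo using (⊥Ω)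
    open OrderedObjectProperties C Ωo
    open Semantics C T F A Ωo alg
    open CoalgebraMorphisms C T F A Ωo alg
    open HistoryMorphism C T F A Ωo alg c
    open ≡-Reasoning
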